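{- Let $\mathbb{G}=\mathbb{G}_1 + \mathbb{G}_2$ be the join of two graphs $\mathbb{G}_1$ and $\mathbb{G}_2.$ Then, $_{\mathbb{G}}d_{td}(a)=2$ for every vertex in $\mathbb{G}.$
   Context: The join $\mathbb{G}_1+\mathbb{G}_2$ is the disjoint union of $\mathbb{G}_1$ and $\mathbb{G}_2$ together with all edges joining each vertex of $\mathbb{G}_1$ to every vertex of $\mathbb{G}_2$. A total dominating set (TDS) is a vertex set $S$ such that every vertex is adjacent to a vertex of $S$; a minimal TDS (MTDS) has no proper subset that is a TDS. $_{\mathbb{G}}d_{td}(a)=\min\{|S| : S \text{ an MTDS of } \mathbb{G} \text{ containing } a\}$. -}

module Defs where

open import Data.Nat using (ℕ; suc; _+_; _≤_)
open import Data.Bool using (Bool; true; false)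
open import Data.Fin using (Fin; splitAt)
open import Data.Fin.Subset using (Subset; _∈_; _⊂_; ∣_∣)
open import Data.Sum using (_⊎_; inj₁; inj₂)
open import Data.Product using (Σ; ∃; _×_)
open import Relation.Nullary using (¬_)
open import Relation.Binary.PropositionalEquality using (_≡_)

record Graph (n : ℕ) : Set where
  field
    adj    : Fin n → Fin n → Bool
    sym    : ∀ u v → adj u v ≡ adj v u
    irrefl : ∀ v → adj v v ≡ false
open Graph public

Adj : ∀ {n} → Graph n → Fin n → Fin n → Set
Adj G u v = adj G u v ≡ true

-- adjacency of the join on Fin (n + m): first n vertices are G₁, last m are G₂
joinAdj : ∀ {n m} → Graph n → Graph m → Fin (n + m) → Fin (n + m) → Bool
joinAdj {n} G₁ G₂ u v with splitAt n u | splitAt n v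
... | inj₁ x | inj₁ y = adj G₁ x y
... | inj₂ x | inj₂ y = adj G₂ x y
... | inj₁ _ | inj₂ _ = true
... | inj₂ _ | inj₁ _ = true

joinSym : ∀ {n m} (G₁ : Graph n) (G₂ : Graph m) u v →
          joinAdj G₁ G₂ u v ≡ joinAdj G₁ G₂ v u
joinSym {n} G₁ G₂ u v with splitAt n u | splitAt n v
... | inj₁ x | inj₁ y = sym G₁ x y
... | inj₂ x | inj₂ y = sym G₂ x y
... | inj₁ _ | inj₂ _ = _≡_.refl
... | inj₂ _ | inj₁ _ = _≡_.refl

joinIrrefl : ∀ {n m} (G₁ : Graph n) (G₂ : Graph m) v → joinAdj G₁ G₂ v v ≡ false
joinIrrefl {n} G₁ G₂ v with splitAt n v
... | inj₁ x = irrefl G₁ x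
... | inj₂ x = irrefl G₂ x

_⊕_ : ∀ {n m} → Graph n → Graph m → Graph (n + m)
G₁ ⊕ G₂ = record { adj = joinAdj G₁ G₂ ; sym = joinSym G₁ G₂ ; irrefl = joinIrrefl G₁ G₂ }

IsTDS : ∀ {n} → Graph n → Subset n → Set
IsTDS G S = ∀ v → ∃ λ u → u ∈ S × Adj G v u

IsMTDS : ∀ {n} → Graph n → Subset n → Set
IsMTDS G S = IsTDS G S × (∀ T → T ⊂ S → ¬ IsTDS G T)

-- d_td(a) = k : k is the minimum of |S| over MTDSs S containing a
-- (the minimum is attained and is a lower bound)
Dtd : ∀ {n} → Graph n → Fin n → ℕ → Set
Dtd G a k = (∃ λ S → IsMTDS G S × a ∈ S × ∣ S ∣ ≡ k)
          × (∀ S → IsMTDS G S → a ∈ S → k ≤ ∣ S ∣)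

{-# OPTIONS --safe #-}
module Submission where

-- A total dominating set through a contains a neighbour of a, so it has at least two
-- elements. Conversely, in a join any two vertices on opposite sides dominate
-- everything, and a two-element total dominating set {x, y} is automatically
-- minimal: a total dominating subset must contain a neighbour of y, which can only
-- be x, and likewise y.

open import Defs hiding (sym)
open import Data.Nat using (suc; _+_; _≤_)
open import Data.Bool using (Bool; true; false)
import Data.Bool.Properties as Bool
open import Data.Fin using (Fin; zero; suc; splitAt; _↑ʳ_)
open import Data.Fin.Properties using (splitAt-↑ʳ)
open import Data.Fin.Subset using (_∈_; _⊆_; _⊂_; ∣_∣; ⁅_⁆; _∪_)
open import Data.Fin.Subset.Properties
  using (x∈⁅x⁆; x∈⁅y⁆⇒x≡y; ∣⁅x⁆∣≡1; p⊆q⇒∣p∣≤∣q∣; x∈p∪q⁻; x∈p∪q⁺; ∪-comm; ∪-identityˡ; ∪-identityʳ)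
open import Data.Sum using (_⊎_; inj₁; inj₂; [_,_]′)
import Data.Sum as Sum
open import Data.Product using (∃; _,_; proj₁)
open import Function using (const; _∘′_)
open import Relation.Nullary using (¬_; yes; no; contradiction)
open import Relation.Binary.PropositionalEquality
  using (_≡_; _≢_; refl; sym; trans; cong; subst)

∣⁅x⁆∪⁅y⁆∣≡2 : ∀ {n} {x y : Fin n} → x ≢ y → ∣ ⁅ x ⁆ ∪ ⁅ y ⁆ ∣ ≡ 2
∣⁅x⁆∪⁅y⁆∣≡2 {x = zero}  {zero}  x≢y = contradiction refl x≢y
∣⁅x⁆∪⁅y⁆∣≡2 {x = zero}  {suc y} _   = cong suc (trans (cong ∣_∣ (∪-identityˡ ⁅ y ⁆)) (∣⁅x⁆∣≡1 y))
∣⁅x⁆∪⁅y⁆∣≡2 {x = suc x} {zero}  _   = cong suc (trans (cong ∣_∣ (∪-identityʳ ⁅ x ⁆)) (∣⁅x⁆∣≡1 x))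
∣⁅x⁆∪⁅y⁆∣≡2 {x = suc x} {suc y} x≢y = ∣⁅x⁆∪⁅y⁆∣≡2 (x≢y ∘′ cong suc)

x∈⁅y⁆∪⁅z⁆⇒x≡y⊎x≡z : ∀ {n} {x y z : Fin n} → x ∈ ⁅ y ⁆ ∪ ⁅ z ⁆ → x ≡ y ⊎ x ≡ z
x∈⁅y⁆∪⁅z⁆⇒x≡y⊎x≡z {y = y} {z} x∈ = Sum.map (x∈⁅y⁆⇒x≡y y) (x∈⁅y⁆⇒x≡y z) (x∈p∪q⁻ ⁅ y ⁆ ⁅ z ⁆ x∈)

module _ {n} (G : Graph n) where

  Adj⇒≢ : ∀ {u v} → Adj G u v → u ≢ v
  Adj⇒≢ {u} uv refl = contradiction (trans (sym uv) (irrefl G u)) λ ()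

  Adj-∈⁅v⁆∪⁅w⁆⇒≡w : ∀ {u v w} → Adj G v u → u ∈ ⁅ v ⁆ ∪ ⁅ w ⁆ → u ≡ w
  Adj-∈⁅v⁆∪⁅w⁆⇒≡w vu u∈ with x∈⁅y⁆∪⁅z⁆⇒x≡y⊎x≡z u∈
  ... | inj₁ refl = contradiction refl (Adj⇒≢ vu)
  ... | inj₂ u≡w  = u≡w

  isTDS-∋⇒2≤∣S∣ : ∀ {S a} → IsTDS G S → a ∈ S → 2 ≤ ∣ S ∣
  isTDS-∋⇒2≤∣S∣ {S} {a} tds a∈S =
    let u , u∈S , au = tds a in
    subst (_≤ ∣ S ∣) (∣⁅x⁆∪⁅y⁆∣≡2 (Adj⇒≢ au)) (p⊆q⇒∣p∣≤∣q∣ (⁅a⁆∪⁅u⁆⊆S u∈S))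
    where
    ⁅a⁆∪⁅u⁆⊆S : ∀ {u} → u ∈ S → ⁅ a ⁆ ∪ ⁅ u ⁆ ⊆ S
    ⁅a⁆∪⁅u⁆⊆S u∈S x∈ with x∈⁅y⁆∪⁅z⁆⇒x≡y⊎x≡z x∈
    ... | inj₁ refl = a∈S
    ... | inj₂ refl = u∈S

  isTDS-⊆⁅y⁆∪⁅x⁆⇒x∈T : ∀ {T x y} → IsTDS G T → T ⊆ ⁅ y ⁆ ∪ ⁅ x ⁆ → x ∈ T
  isTDS-⊆⁅y⁆∪⁅x⁆⇒x∈T {y = y} tds T⊆ =
    let u , u∈T , yu = tds y in
    subst (_∈ _) (Adj-∈⁅v⁆∪⁅w⁆⇒≡w yu (T⊆ u∈T)) u∈T

  ⁅x⁆∪⁅y⁆-minimal : ∀ {x y} T → T ⊂ ⁅ x ⁆ ∪ ⁅ y ⁆ → ¬ IsTDS G T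
  ⁅x⁆∪⁅y⁆-minimal {x} {y} T (T⊆ , z , z∈ , z∉T) tds with x∈⁅y⁆∪⁅z⁆⇒x≡y⊎x≡z z∈
  ... | inj₁ refl = z∉T (isTDS-⊆⁅y⁆∪⁅x⁆⇒x∈T tds (subst (T ⊆_) (∪-comm ⁅ x ⁆ ⁅ y ⁆) T⊆))
  ... | inj₂ refl = z∉T (isTDS-⊆⁅y⁆∪⁅x⁆⇒x∈T tds T⊆)

  isTDS-⁅a⁆∪⁅b⁆⇒Dtd≡2 : ∀ {a b} → IsTDS G (⁅ a ⁆ ∪ ⁅ b ⁆) → Dtd G a 2
  isTDS-⁅a⁆∪⁅b⁆⇒Dtd≡2 {a} {b} tds =
    (⁅ a ⁆ ∪ ⁅ b ⁆ , (tds , ⁅x⁆∪⁅y⁆-minimal) , x∈p∪q⁺ (inj₁ (x∈⁅x⁆ a)) , ∣⁅x⁆∪⁅y⁆∣≡2 a≢b)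
    , λ S mtds a∈S → isTDS-∋⇒2≤∣S∣ (proj₁ mtds) a∈S
    where
    a≢b : a ≢ b
    a≢b a≡b = let u , u∈ , au = tds a in
      Adj⇒≢ au (trans a≡b (sym (Adj-∈⁅v⁆∪⁅w⁆⇒≡w au u∈)))

isLeft : ∀ n {m} → Fin (n + m) → Bool
isLeft n v = [ const true , const false ]′ (splitAt n v)

module _ {n m} (G₁ : Graph n) (G₂ : Graph m) where

  isLeft-≢⇒Adj : ∀ {u v} → isLeft n u ≢ isLeft n v → Adj (G₁ ⊕ G₂) u v
  isLeft-≢⇒Adj {u} {v} sides with splitAt n u | splitAt n v
  ... | inj₁ _ | inj₁ _ = contradiction refl sides
  ... | inj₁ _ | inj₂ _ = refl
  ... | inj₂ _ | inj₁ _ = refl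
  ... | inj₂ _ | inj₂ _ = contradiction refl sides

  isLeft-≢⇒isTDS : ∀ {u v} → isLeft n u ≢ isLeft n v → IsTDS (G₁ ⊕ G₂) (⁅ u ⁆ ∪ ⁅ v ⁆)
  isLeft-≢⇒isTDS {u} {v} u≁v w with isLeft n w Bool.≟ isLeft n u
  ... | yes w∼u = v , x∈p∪q⁺ (inj₂ (x∈⁅x⁆ v)) , isLeft-≢⇒Adj (λ w∼v → u≁v (trans (sym w∼u) w∼v))
  ... | no  w≁u = u , x∈p∪q⁺ (inj₁ (x∈⁅x⁆ u)) , isLeft-≢⇒Adj w≁u

isLeft-↑ʳ : ∀ n {m} (y : Fin m) → isLeft n (n ↑ʳ y) ≡ false
isLeft-↑ʳ n {m} y rewrite splitAt-↑ʳ n m y = refl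

∃-opposite : ∀ {n m} (a : Fin (suc n + suc m)) → ∃ λ b → isLeft (suc n) a ≢ isLeft (suc n) b
∃-opposite {n} {m} a with isLeft (suc n) a
... | true  = suc n ↑ʳ zero {m} , λ t≡ → contradiction (trans t≡ (isLeft-↑ʳ (suc n) (zero {m}))) λ ()
... | false = zero , λ ()

proposition5 : ∀ {n m} (G₁ : Graph (suc n)) (G₂ : Graph (suc m)) →
    (a : Fin (suc n + suc m)) → Dtd (G₁ ⊕ G₂) a 2
proposition5 {n} {m} G₁ G₂ a =
  let b , a≁b = ∃-opposite {n} {m} a in
  isTDS-⁅a⁆∪⁅b⁆⇒Dtd≡2 (G₁ ⊕ G₂) (isLeft-≢⇒isTDS G₁ G₂ {v = b} a≁b)
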